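{- A finite simple graph $G$ is isomorphic to $S\Omega(\Gamma)$ for some finite simple graph $\Gamma$ if and only if $G$ has no two adjacent vertices that are structurally equivalent.
   Context: Two vertices $u,v$ of a graph $G$ are structurally equivalent if the transposition $(u\,v)$ (swapping $u,v$, fixing other vertices) is an automorphism of $G$. For a graph $\Gamma$, consider partitions of $V(\Gamma)$ into nonempty parts such that each part induces a complete subgraph and, for any two distinct parts $P,Q$, either every vertex of $P$ is adjacent to every vertex of $Q$ or no vertex of $P$ is adjacent to any vertex of $Q$. The complete skeleton $\Omega(\Gamma)$ is such a partition with the minimum number of parts; its structure $S\Omega(\Gamma)$ is the simple graph whose vertices are the parts, two parts being adjacent iff they are completely joined. -}

module Defs where

open import Data.Nat using (ℕ; _≤_)
open import Data.Fin using (Fin)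
open import Data.Bool using (Bool; true; false)
open import Data.Product using (Σ; _×_; ∃)
open import Relation.Binary.PropositionalEquality using (_≡_; _≢_)
open import Relation.Nullary using (¬_)
open import Data.Fin.Permutation using (Permutation′; transpose; _⟨$⟩ʳ_)
open import Function.Bundles using (_↔_; Inverse; _⇔_)

record Graph (n : ℕ) : Set where
  field
    adj    : Fin n → Fin n → Bool
    sym    : ∀ i j → adj i j ≡ adj j i
    irrefl : ∀ i → adj i i ≡ false
open Graph public

Adj : ∀ {n} → Graph n → Fin n → Fin n → Set
Adj G i j = adj G i j ≡ true

IsAutomorphism : ∀ {n} → Graph n → Permutation′ n → Set
IsAutomorphism G σ = ∀ i j → adj G (σ ⟨$⟩ʳ i) (σ ⟨$⟩ʳ j) ≡ adj G i j

StructurallyEquivalent : ∀ {n} → Graph n → Fin n → Fin n → Set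
StructurallyEquivalent G u v = IsAutomorphism G (transpose u v)

-- A partition of V(Γ) into k nonempty parts, given by the part map p
-- (surjectivity = parts nonempty), such that each part is a clique and
-- any two distinct parts are either completely joined or not joined at all.
record IsSkeletonPartition {m : ℕ} (Γ : Graph m) (k : ℕ) (p : Fin m → Fin k) : Set where
  field
    nonempty    : ∀ (P : Fin k) → ∃ λ i → p i ≡ P
    clique      : ∀ i j → p i ≡ p j → i ≢ j → Adj Γ i j
    homogeneous : ∀ i j i′ j′ → p i ≡ p i′ → p j ≡ p j′ → p i ≢ p j →
                  adj Γ i j ≡ adj Γ i′ j′

record IsCompleteSkeleton {m : ℕ} (Γ : Graph m) (k : ℕ) (p : Fin m → Fin k) : Set where
  field
    partition : IsSkeletonPartition Γ k p
    minimal   : ∀ (k′ : ℕ) (q : Fin m → Fin k′) → IsSkeletonPartition Γ k′ q → k ≤ k′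

-- Adjacency in the structure SΩ(Γ): distinct parts that are completely joined.
StructAdj : ∀ {m k} → Graph m → (Fin m → Fin k) → Fin k → Fin k → Set
StructAdj Γ p P Q = P ≢ Q × (∀ i j → p i ≡ P → p j ≡ Q → Adj Γ i j)

IsoToStructure : ∀ {n m k} → Graph n → Graph m → (Fin m → Fin k) → Set
IsoToStructure {n} {m} {k} G Γ p =
  Σ (Fin n ↔ Fin k) λ f →
    ∀ a b → Adj G a b ⇔ StructAdj Γ p (Inverse.to f a) (Inverse.to f b)

-- Two vertices are structurally equivalent exactly when they are twins: they
-- have the same neighbours outside {u, v}. If G has no adjacent twins, every
-- skeleton partition of G is injective (two distinct vertices in one part
-- are adjacent twins), so the partition into singletons is the complete
-- skeleton of Γ = G and SΩ(G) = G. Conversely, if G ≅ SΩ(Γ) has adjacent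
-- twins u, v, then the parts of u and v are completely joined and see every
-- other part alike, so fusing them gives a skeleton partition with fewer
-- parts, contradicting minimality.
module Submission where

open import Defs
open import Data.Nat using (ℕ; suc)
open import Data.Nat.Properties using (1+n≰n)
open import Data.Fin using (Fin; _≟_; punchOut; punchIn)
open import Data.Fin.Properties
  using (punchOut-cong; punchOut-injective; punchOut-punchIn; punchInᵢ≢i; injective⇒≤)
open import Data.Fin.Permutation using (transpose; _⟨$⟩ʳ_)
open import Data.Product using (Σ; _×_; ∃; _,_; proj₁; proj₂)
open import Data.Sum using (_⊎_; inj₁; inj₂)
open import Data.Bool using (Bool; true; false)
open import Data.Empty using (⊥-elim)
open import Function using (id; _∘_)
open import Function.Bundles using (_⇔_; _↔_; Inverse; Equivalence; mk⇔)
open import Function.Construct.Identity using (↔-id)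
open import Relation.Nullary using (¬_; yes; no)
open import Relation.Nullary.Decidable using (dec-true; dec-false)
open import Relation.Binary.PropositionalEquality
  using (_≡_; _≢_; refl; trans; cong; subst₂; module ≡-Reasoning)
  renaming (sym to ≡-sym)

private
  variable
    n m k : ℕ

Bool-≡-from-⇔ : ∀ {a b : Bool} → (a ≡ true → b ≡ true) → (b ≡ true → a ≡ true) → a ≡ b
Bool-≡-from-⇔ {false} {false} _ _ = refl
Bool-≡-from-⇔ {false} {true}  _ b⇒a = b⇒a refl
Bool-≡-from-⇔ {true}  {false} a⇒b _ = ≡-sym (a⇒b refl)
Bool-≡-from-⇔ {true}  {true}  _ _ = refl

data TransposeView {n} (u v a : Fin n) : Fin n → Set where
  at-u      : a ≡ u → TransposeView u v a v
  at-v      : a ≡ v → TransposeView u v a u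
  elsewhere : a ≢ u → a ≢ v → TransposeView u v a a

transpose-view : ∀ (u v a : Fin n) → TransposeView u v a (transpose u v ⟨$⟩ʳ a)
transpose-view u v a with a ≟ u
... | yes a≡u = at-u a≡u
... | no a≢u with a ≟ v
...   | yes a≡v = at-v a≡v
...   | no a≢v = elsewhere a≢u a≢v

transpose-matchˡ : ∀ (u v : Fin n) → transpose u v ⟨$⟩ʳ u ≡ v
transpose-matchˡ u v rewrite dec-true (u ≟ u) refl = refl

transpose-fixes : ∀ {u v w : Fin n} → w ≢ u → w ≢ v → transpose u v ⟨$⟩ʳ w ≡ w
transpose-fixes {u = u} {v} {w} w≢u w≢v
  rewrite dec-false (w ≟ u) w≢u | dec-false (w ≟ v) w≢v = refl

Twins : Graph n → Fin n → Fin n → Set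
Twins {n} G u v = ∀ (w : Fin n) → w ≢ u → w ≢ v → adj G u w ≡ adj G v w

structurallyEquivalent⇒twins : ∀ (G : Graph n) {u v} → StructurallyEquivalent G u v → Twins G u v
structurallyEquivalent⇒twins G {u} {v} se w w≢u w≢v =
  ≡-sym (subst₂ (λ x y → adj G x y ≡ adj G u w)
                (transpose-matchˡ u v) (transpose-fixes w≢u w≢v) (se u w))

module _ (G : Graph n) {u v : Fin n} (twins : Twins G u v) where

  private
    transpose-preservesˡ : ∀ {a a′ w} → w ≢ u → w ≢ v →
                           TransposeView u v a a′ → adj G a′ w ≡ adj G a w
    transpose-preservesˡ {w = w} w≢u w≢v (at-u refl)       = ≡-sym (twins w w≢u w≢v)
    transpose-preservesˡ {w = w} w≢u w≢v (at-v refl)       = twins w w≢u w≢v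
    transpose-preservesˡ          _   _   (elsewhere _ _)   = refl

    irrefl-both : ∀ x y → adj G x x ≡ adj G y y
    irrefl-both x y = trans (irrefl G x) (≡-sym (irrefl G y))

  twins⇒structurallyEquivalent : StructurallyEquivalent G u v
  twins⇒structurallyEquivalent a b
    with transpose u v ⟨$⟩ʳ a | transpose-view u v a | transpose u v ⟨$⟩ʳ b | transpose-view u v b
  ... | _ | view-a | _ | elsewhere b≢u b≢v = transpose-preservesˡ b≢u b≢v view-a
  ... | _ | elsewhere a≢u a≢v | b′ | view-b =
    trans (Graph.sym G a b′) (trans (transpose-preservesˡ a≢u a≢v view-b) (Graph.sym G b a))
  ... | _ | at-u refl | _ | at-u refl = irrefl-both v u
  ... | _ | at-u refl | _ | at-v refl = Graph.sym G v u
  ... | _ | at-v refl | _ | at-u refl = Graph.sym G u v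
  ... | _ | at-v refl | _ | at-v refl = irrefl-both u v

module _ {Γ : Graph m} {p : Fin m → Fin k} (sp : IsSkeletonPartition Γ k p) where

  open IsSkeletonPartition sp

  samePart⇒twins : ∀ {i j} → p i ≡ p j → Twins Γ i j
  samePart⇒twins {i} {j} pi≡pj w w≢i w≢j with p i ≟ p w
  ... | yes pi≡pw = trans (clique i w pi≡pw (w≢i ∘ ≡-sym))
                          (≡-sym (clique j w (trans (≡-sym pi≡pj) pi≡pw) (w≢j ∘ ≡-sym)))
  ... | no pi≢pw = homogeneous i w j w pi≡pj refl pi≢pw

  adjacent⇒joined : ∀ {a b} → p a ≢ p b → Adj Γ a b → StructAdj Γ p (p a) (p b)
  adjacent⇒joined {a} {b} pa≢pb ab = pa≢pb , λ i j pi≡pa pj≡pb →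
    trans (homogeneous i j a b pi≡pa pj≡pb (λ e → pa≢pb (trans (≡-sym pi≡pa) (trans e pj≡pb)))) ab

id-isSkeletonPartition : ∀ (G : Graph n) → IsSkeletonPartition G n id
id-isSkeletonPartition G = record
  { nonempty    = λ P → P , refl
  ; clique      = λ i j i≡j i≢j → ⊥-elim (i≢j i≡j)
  ; homogeneous = λ { i j _ _ refl refl _ → refl }
  }

id-structure : ∀ (G : Graph n) a b → Adj G a b ⇔ StructAdj G id a b
id-structure G a b = mk⇔
  (λ ab → (λ { refl → loop ab }) , λ { _ _ refl refl → ab })
  (λ s → proj₂ s a b refl refl)
  where
  loop : ¬ Adj G a a
  loop aa with trans (≡-sym (irrefl G a)) aa
  ... | ()

NoAdjacentStructurallyEquivalent : Graph n → Set
NoAdjacentStructurallyEquivalent {n} G = ∀ (u v : Fin n) → Adj G u v → ¬ StructurallyEquivalent G u v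

skeletonPartition-injective : ∀ {G : Graph n} {q : Fin n → Fin k} →
  NoAdjacentStructurallyEquivalent G → IsSkeletonPartition G k q → ∀ {i j} → q i ≡ q j → i ≡ j
skeletonPartition-injective {G = G} noSE sp {i} {j} qi≡qj with i ≟ j
... | yes i≡j = i≡j
... | no i≢j  = ⊥-elim (noSE i j (IsSkeletonPartition.clique sp i j qi≡qj i≢j)
                                 (twins⇒structurallyEquivalent G (samePart⇒twins sp qi≡qj)))

id-isCompleteSkeleton : ∀ {G : Graph n} → NoAdjacentStructurallyEquivalent G → IsCompleteSkeleton G n id
id-isCompleteSkeleton {G = G} noSE = record
  { partition = id-isSkeletonPartition G
  ; minimal   = λ k′ q sp → injective⇒≤ (skeletonPartition-injective noSE sp)
  }

record TwinParts {m k} (Γ : Graph m) (p : Fin m → Fin k) (P Q : Fin k) : Set where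
  field
    joined         : StructAdj Γ p P Q
    sameNeighbours : ∀ i j c → p i ≡ P → p j ≡ Q → p c ≢ P → p c ≢ Q → adj Γ i c ≡ adj Γ j c

module Fusion {P Q : Fin (suc k)} (P≢Q : P ≢ Q) where

  redirect : Fin (suc k) → Fin (suc k)
  redirect X with X ≟ Q
  ... | yes _ = P
  ... | no _  = X

  redirect≢Q : ∀ X → Q ≢ redirect X
  redirect≢Q X with X ≟ Q
  ... | yes _   = λ Q≡P → P≢Q (≡-sym Q≡P)
  ... | no X≢Q  = λ Q≡X → X≢Q (≡-sym Q≡X)

  redirect-fixes : ∀ {X} → X ≢ Q → redirect X ≡ X
  redirect-fixes {X} X≢Q with X ≟ Q
  ... | yes X≡Q = ⊥-elim (X≢Q X≡Q)
  ... | no _    = refl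

  fuse : Fin (suc k) → Fin k
  fuse X = punchOut (redirect≢Q X)

  fuse-surjective : ∀ T → ∃ λ X → fuse X ≡ T
  fuse-surjective T =
    punchIn Q T , trans (punchOut-cong Q (redirect-fixes (punchInᵢ≢i Q T))) (punchOut-punchIn Q)

  fuse-onPair : ∀ {X} → X ≡ P ⊎ X ≡ Q → fuse X ≡ fuse P
  fuse-onPair {X} X∈PQ = punchOut-cong Q (redirect-onPair X∈PQ)
    where
    redirect-onPair : X ≡ P ⊎ X ≡ Q → redirect X ≡ redirect P
    redirect-onPair X∈PQ with X ≟ Q | P ≟ Q | X∈PQ
    ... | _       | yes P≡Q  | _        = ⊥-elim (P≢Q P≡Q)
    ... | yes _   | no _     | _        = refl
    ... | no _    | no _     | inj₁ X≡P = X≡P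
    ... | no X≢Q  | no _     | inj₂ X≡Q = ⊥-elim (X≢Q X≡Q)

  fuse-kernel : ∀ {X Y} → fuse X ≡ fuse Y → X ≡ Y ⊎ (X ≡ P × Y ≡ Q) ⊎ (X ≡ Q × Y ≡ P)
  fuse-kernel {X} {Y} fX≡fY with X ≟ Q | Y ≟ Q | punchOut-injective (redirect≢Q X) (redirect≢Q Y) fX≡fY
  ... | yes X≡Q | yes Y≡Q | _    = inj₁ (trans X≡Q (≡-sym Y≡Q))
  ... | yes X≡Q | no _    | P≡Y  = inj₂ (inj₂ (X≡Q , ≡-sym P≡Y))
  ... | no _    | yes Y≡Q | X≡P  = inj₂ (inj₁ (X≡P , Y≡Q))
  ... | no _    | no _    | X≡Y  = inj₁ X≡Y

  fuse-apart : ∀ {X Y} → X ≡ P ⊎ X ≡ Q → fuse X ≢ fuse Y → Y ≢ P × Y ≢ Q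
  fuse-apart X∈PQ fX≢fY =
    (λ Y≡P → fX≢fY (trans (fuse-onPair X∈PQ) (≡-sym (fuse-onPair (inj₁ Y≡P))))) ,
    (λ Y≡Q → fX≢fY (trans (fuse-onPair X∈PQ) (≡-sym (fuse-onPair (inj₂ Y≡Q)))))

module _ {Γ : Graph m} {p : Fin m → Fin (suc k)} {P Q : Fin (suc k)}
         (sp : IsSkeletonPartition Γ (suc k) p) (twin : TwinParts Γ p P Q) where

  open IsSkeletonPartition sp
  open TwinParts twin
  open Fusion (proj₁ joined)

  private
    q : Fin m → Fin k
    q = fuse ∘ p

    fusedPart-homogeneousˡ : ∀ {a a′ c} → q a ≡ q a′ → q a ≢ q c → adj Γ a c ≡ adj Γ a′ c
    fusedPart-homogeneousˡ {a} {a′} {c} qa≡qa′ qa≢qc with fuse-kernel qa≡qa′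
    ... | inj₁ pa≡pa′ = homogeneous a c a′ c pa≡pa′ refl (qa≢qc ∘ cong fuse)
    ... | inj₂ (inj₁ (pa≡P , pa′≡Q)) =
      let c∉PQ = fuse-apart (inj₁ pa≡P) qa≢qc
      in sameNeighbours a a′ c pa≡P pa′≡Q (proj₁ c∉PQ) (proj₂ c∉PQ)
    ... | inj₂ (inj₂ (pa≡Q , pa′≡P)) =
      let c∉PQ = fuse-apart (inj₂ pa≡Q) qa≢qc
      in ≡-sym (sameNeighbours a′ a c pa′≡P pa≡Q (proj₁ c∉PQ) (proj₂ c∉PQ))

  fuse-isSkeletonPartition : IsSkeletonPartition Γ k (fuse ∘ p)
  fuse-isSkeletonPartition = record
    { nonempty    = fused-nonempty
    ; clique      = fused-clique
    ; homogeneous = fused-homogeneous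
    }
    where
    fused-nonempty : ∀ T → ∃ λ i → q i ≡ T
    fused-nonempty T with fuse-surjective T
    ... | X , fX≡T with nonempty X
    ...   | i , pi≡X = i , trans (cong fuse pi≡X) fX≡T

    fused-clique : ∀ i j → q i ≡ q j → i ≢ j → Adj Γ i j
    fused-clique i j qi≡qj i≢j with fuse-kernel qi≡qj
    ... | inj₁ pi≡pj                 = clique i j pi≡pj i≢j
    ... | inj₂ (inj₁ (pi≡P , pj≡Q)) = proj₂ joined i j pi≡P pj≡Q
    ... | inj₂ (inj₂ (pi≡Q , pj≡P)) = trans (Graph.sym Γ i j) (proj₂ joined j i pj≡P pi≡Q)

    fused-homogeneous : ∀ i j i′ j′ → q i ≡ q i′ → q j ≡ q j′ → q i ≢ q j → adj Γ i j ≡ adj Γ i′ j′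
    fused-homogeneous i j i′ j′ qi≡qi′ qj≡qj′ qi≢qj = begin
      adj Γ i j    ≡⟨ fusedPart-homogeneousˡ qi≡qi′ qi≢qj ⟩
      adj Γ i′ j   ≡⟨ Graph.sym Γ i′ j ⟩
      adj Γ j i′   ≡⟨ fusedPart-homogeneousˡ qj≡qj′ (λ qj≡qi′ → qi≢qj (trans qi≡qi′ (≡-sym qj≡qi′))) ⟩
      adj Γ j′ i′  ≡⟨ Graph.sym Γ j′ i′ ⟩
      adj Γ i′ j′  ∎
      where open ≡-Reasoning

completeSkeleton-noTwinParts : ∀ {Γ : Graph m} {p : Fin m → Fin k} {P Q} →
  IsCompleteSkeleton Γ k p → ¬ TwinParts Γ p P Q
completeSkeleton-noTwinParts {k = suc k} cs twin =
  1+n≰n (minimal k _ (fuse-isSkeletonPartition partition twin))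
  where open IsCompleteSkeleton cs

module _ (G : Graph n) {Γ : Graph m} {p : Fin m → Fin k}
         (sp : IsSkeletonPartition Γ k p) (f : Fin n ↔ Fin k)
         (iso : ∀ a b → Adj G a b ⇔ StructAdj Γ p (Inverse.to f a) (Inverse.to f b)) where

  open Inverse f using (to; from; strictlyInverseˡ)

  adj-acrossParts : ∀ {x y a b} → p a ≡ to x → p b ≡ to y → p a ≢ p b → adj Γ a b ≡ adj G x y
  adj-acrossParts {x} {y} {a} {b} pa≡x pb≡y pa≢pb = Bool-≡-from-⇔
    (λ ab → Equivalence.from (iso x y) (subst₂ (StructAdj Γ p) pa≡x pb≡y (adjacent⇒joined sp pa≢pb ab)))
    (λ xy → proj₂ (Equivalence.to (iso x y) xy) a b pa≡x pb≡y)

  twins⇒twinParts : ∀ {u v} → Adj G u v → Twins G u v → TwinParts Γ p (to u) (to v)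
  twins⇒twinParts {u} {v} uv twins = record
    { joined         = Equivalence.to (iso u v) uv
    ; sameNeighbours = sameNeighbours
    }
    where
    sameNeighbours : ∀ i j c → p i ≡ to u → p j ≡ to v → p c ≢ to u → p c ≢ to v → adj Γ i c ≡ adj Γ j c
    sameNeighbours i j c pi≡u pj≡v pc≢u pc≢v = begin
      adj Γ i c  ≡⟨ adj-acrossParts pi≡u pc≡w (λ pi≡pc → pc≢u (trans (≡-sym pi≡pc) pi≡u)) ⟩
      adj G u w  ≡⟨ twins w (λ w≡u → pc≢u (trans pc≡w (cong to w≡u)))
                           (λ w≡v → pc≢v (trans pc≡w (cong to w≡v))) ⟩
      adj G v w  ≡⟨ ≡-sym (adj-acrossParts pj≡v pc≡w (λ pj≡pc → pc≢v (trans (≡-sym pj≡pc) pj≡v))) ⟩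
      adj Γ j c  ∎
      where
      open ≡-Reasoning
      w : Fin n
      w = from (p c)
      pc≡w : p c ≡ to w
      pc≡w = ≡-sym (strictlyInverseˡ (p c))

theorem4p4 : ∀ (n : ℕ) (G : Graph n) →
    (Σ ℕ λ m → Σ (Graph m) λ Γ → Σ ℕ λ k → Σ (Fin m → Fin k) λ p →
       IsCompleteSkeleton Γ k p × IsoToStructure {n} {m} {k} G Γ p)
    ⇔ (∀ (u v : Fin n) → Adj G u v → ¬ StructurallyEquivalent G u v)
theorem4p4 n G = mk⇔
  (λ { (m , Γ , k , p , cs , f , iso) u v uv se →
       completeSkeleton-noTwinParts cs
         (twins⇒twinParts G (IsCompleteSkeleton.partition cs) f iso uv
           (structurallyEquivalent⇒twins G se)) })
  (λ noSE → n , G , n , id , id-isCompleteSkeleton noSE , ↔-id (Fin n) , id-structure G)
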